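{- Let $G=(V,E)$ be a finite graph with $n$ vertices and maximum degree $\Delta$, and let $q\ge\Delta+2$ colors be available. In the self-organizing network coloring game on $G$ with $q$ colors in which every player uses the greedy and selfish strategy, with probability one all players eventually have payoff equal to $1$ (i.e. the coloring becomes proper), after which no player changes color and the game stops.
   Context: Network coloring game: players are the vertices $1,\dots,n$ of $G$; $N(i)$ denotes the neighbours of $i$. There are $q$ colors. In discrete rounds $t=0,1,2,\dots$ each player $i$ holds a color $l_i(t)$ and has payoff $U_i(t)=1$ if $l_i(t)\ne l_j(t)$ for all $j\in N(i)$ and $U_i(t)=0$ otherwise. Greedy and selfish strategy: a player with payoff $1$ keeps its color; a player with payoff $0$ chooses its next color uniformly at random among the colors not used by any of its neighbours in the previous round, independently of the other players. The initial coloring is arbitrary. -}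

module Defs where

open import Data.Nat as ℕ using (ℕ; zero; suc; _⊔_)
open import Data.Integer using (+_)
open import Data.Fin using (Fin; zero; suc)
open import Data.Fin.Properties using (_≟_)
open import Data.Bool using (Bool; true; false; if_then_else_; _∧_; not; T)
open import Data.List using (List; []; _∷_; map; foldr; filter; length; concatMap; allFin)
open import Data.Bool.ListAction using (all; any)
open import Data.Rational using (ℚ; 0ℚ; 1ℚ; _/_; _+_; _*_)
open import Data.Vec.Functional as VF using (Vector)
open import Relation.Nullary.Decidable using (⌊_⌋)
open import Relation.Binary.PropositionalEquality using (_≡_)

record Graph (n : ℕ) : Set where
  field
    adj   : Fin n → Fin n → Bool
    sym   : ∀ i j → adj i j ≡ adj j i
    irrefl : ∀ i → adj i i ≡ false
open Graph public

degree : ∀ {n} → Graph n → Fin n → ℕ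
degree G i = length (filter (λ j → T? (adj G i j)) (allFin _))
  where
  open import Data.Bool.Properties using (T?)

maxDegree : ∀ {n} → Graph n → ℕ
maxDegree G = foldr _⊔_ 0 (map (degree G) (allFin _))

Coloring : ℕ → ℕ → Set
Coloring n q = Fin n → Fin q

_==ᶠ_ : ∀ {q} → Fin q → Fin q → Bool
a ==ᶠ b = ⌊ a ≟ b ⌋

usedByNbr : ∀ {n q} → Graph n → Coloring n q → Fin n → Fin q → Bool
usedByNbr G c i k = any (λ j → adj G i j ∧ (c j ==ᶠ k)) (allFin _)

-- payoff U_i = 1 (true) iff i's colour differs from all neighbours' colours
payoff : ∀ {n q} → Graph n → Coloring n q → Fin n → Bool
payoff G c i = not (usedByNbr G c i (c i))

proper : ∀ {n q} → Graph n → Coloring n q → Bool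
proper G c = all (payoff G c) (allFin _)

nAvailable : ∀ {n q} → Graph n → Coloring n q → Fin n → ℕ
nAvailable G c i = length (filter (λ k → T? (not (usedByNbr G c i k))) (allFin _))
  where
  open import Data.Bool.Properties using (T?)

-- 1 / m  (taken to be 0 when m = 0; this case never arises when q ≥ Δ + 1)
inv : ℕ → ℚ
inv zero    = 0ℚ
inv (suc m) = + 1 / suc m

-- Greedy and selfish strategy: probability that player i holds colour k
-- in the next round, given colouring c in the current round.
playerProb : ∀ {n q} → Graph n → Coloring n q → Fin n → Fin q → ℚ
playerProb G c i k =
  if payoff G c i
  then (if k ==ᶠ c i then 1ℚ else 0ℚ)
  else (if usedByNbr G c i k then 0ℚ else inv (nAvailable G c i))

prodFin : ∀ {n} → (Fin n → ℚ) → ℚ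
prodFin f = foldr _*_ 1ℚ (map f (allFin _))

-- one-round transition probability c ↦ c' (players choose independently)
step : ∀ {n q} → Graph n → Coloring n q → Coloring n q → ℚ
step G c c' = prodFin (λ i → playerProb G c i (c' i))

allColorings : (n q : ℕ) → List (Coloring n q)
allColorings zero    q = (λ ()) ∷ []
allColorings (suc n) q =
  concatMap (λ k → map (λ f → k VF.∷ f) (allColorings n q)) (allFin q)

sumℚ : List ℚ → ℚ
sumℚ = foldr _+_ 0ℚ

_==ᶜ_ : ∀ {n q} → Coloring n q → Coloring n q → Bool
c ==ᶜ c' = all (λ i → c i ==ᶠ c' i) (allFin _)

dist : ∀ {n q} → Graph n → Coloring n q → ℕ → Coloring n q → ℚ
dist G c₀ zero    c  = if c ==ᶜ c₀ then 1ℚ else 0ℚ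
dist {n} {q} G c₀ (suc t) c' =
  sumℚ (map (λ c → dist G c₀ t c * step G c c') (allColorings n q))

probProperAt : ∀ {n q} → Graph n → Coloring n q → ℕ → ℚ
probProperAt {n} {q} G c₀ t =
  sumℚ (map (λ c → if proper G c then dist G c₀ t c else 0ℚ) (allColorings n q))

module Submission where

-- Let u(c) be the number of unhappy players of a colouring c.  A happy player keeps its
-- colour, and no neighbour can move onto that colour (a happy neighbour keeps its own, an
-- unhappy one only picks colours unused around it), so almost surely happy players stay
-- happy and u never increases.  Every player has at least q - Δ ≥ 2 colours unused around
-- it.  Hence if c is not proper, fix an unhappy player i₀ and a colour a unused around i₀;
-- the move in which happy players stay, i₀ takes a and every other unhappy player takes an
-- unused colour different from a has probability at least q⁻ⁿ and makes i₀ happy.  So the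
-- expected value of u drops by q⁻ⁿ ≥ δ u(c), where δ = q⁻ⁿ/(n+1), i.e. by a factor 1 - δ
-- per round.  Thus E[u] after t rounds is at most (1 - δ)ᵗ n → 0, and since u ≥ 1 on
-- improper colourings, the probability of being proper is at least 1 - E[u] → 1.  A proper
-- colouring is absorbing because every player is happy.

open import Data.Bool using (Bool; true; false; not; _∧_; _∨_; if_then_else_; T)
open import Data.Bool.ListAction using (or; all; any)
open import Data.Bool.Properties using (T?; T-∧; if-not)
open import Data.Empty using (⊥-elim)
open import Data.Fin using (Fin; zero; suc)
open import Data.Fin.Properties using (_≟_; suc-injective)
open import Data.Integer as ℤ using (+≤+; -≤+; +<+)
import Data.Integer.Properties as ℤ
open import Data.List using (List; []; _∷_; _++_; map; foldr; concatMap; length; filter; tabulate; allFin)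
import Data.List.Properties as List
open import Data.List.Membership.Propositional using (_∈_; lose; find)
open import Data.List.Membership.Propositional.Properties using (∈-allFin; ∈-map⁺; ∈-concatMap⁺)
import Data.List.Relation.Unary.All as All
open import Data.List.Relation.Unary.All.Properties using (all⁺)
open import Data.List.Relation.Unary.Any using (here; there)
open import Data.List.Relation.Unary.Any.Properties using (any⁺; any⁻)
open import Data.Nat as ℕ using (ℕ; zero; suc; z≤n; s≤s)
import Data.Nat.Properties as ℕ
open import Data.Product using (∃-syntax; _×_; _,_; proj₁; proj₂)
open import Data.Rational as ℚ using (ℚ; mkℚ; 0ℚ; 1ℚ; _+_; _*_; _-_; -_; 1/_; _≤_; _<_; *≤*; *<*)
open import Data.Rational.Literals using (fromℤ)
open import Algebra.Definitions.RawSemiring ℚ.+-*-rawSemiring using (_^_)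
open import Data.Rational.Properties as ℚ
  using (≤-refl; ≤-reflexive; ≤-trans; <⇒≤; +-mono-≤; +-monoˡ-≤; +-monoʳ-≤)
open import Data.Rational.Solver using (module +-*-Solver)
open import Data.Sum using (_⊎_; inj₁; inj₂)
open import Data.Unit using (tt)
import Data.Vec.Functional as Vector
open import Defs hiding (sym)
open import Function using (_∘_)
open import Function.Bundles using (Equivalence)
open import Relation.Binary.PropositionalEquality
open import Relation.Nullary using (¬_; Dec; yes; no)
open import Relation.Nullary.Decidable using (⌊⌋-map′; toWitness; fromWitness; toWitnessFalse; fromWitnessFalse)

private variable
  A B : Set

if-T : ∀ {b} {x y : A} → T b → (if b then x else y) ≡ x
if-T {b = true} _ = refl

if-F : ∀ {b} {x y : A} → T (not b) → (if b then x else y) ≡ y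
if-F {b = false} _ = refl

T-or-T-not : ∀ b → T b ⊎ T (not b)
T-or-T-not true  = inj₁ tt
T-or-T-not false = inj₂ tt

T-not-¬ : ∀ {b} → T (not b) → ¬ T b
T-not-¬ {true} ()

-- Rational arithmetic

0≤1 : 0ℚ ≤ 1ℚ
0≤1 = ℚ.nonNegative⁻¹ 1ℚ

if-nonNeg : ∀ b {x y} → 0ℚ ≤ x → 0ℚ ≤ y → 0ℚ ≤ (if b then x else y)
if-nonNeg true  0≤x 0≤y = 0≤x
if-nonNeg false 0≤x 0≤y = 0≤y

p+q-q≡p : ∀ p q → p + q - q ≡ p
p+q-q≡p p q = trans (ℚ.+-assoc p q (- q)) (trans (cong (p +_) (ℚ.+-inverseʳ q)) (ℚ.+-identityʳ p))

p-q≤p : ∀ {p q} → 0ℚ ≤ q → p - q ≤ p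
p-q≤p {p} 0≤q = ≤-trans (+-monoʳ-≤ p (ℚ.neg-antimono-≤ 0≤q)) (≤-reflexive (ℚ.+-identityʳ p))

p≤q⇒0≤q-p : ∀ {p q} → p ≤ q → 0ℚ ≤ q - p
p≤q⇒0≤q-p {p} p≤q = ≤-trans (≤-reflexive (sym (ℚ.+-inverseʳ p))) (+-monoˡ-≤ (- p) p≤q)

p≤q+r⇒p-s≤q : ∀ {p q r s} → r ≤ s → p ≤ q + r → p - s ≤ q
p≤q+r⇒p-s≤q {p} {q} {r} {s} r≤s p≤q+r = begin
  p - s        ≤⟨ +-mono-≤ p≤q+r (ℚ.neg-antimono-≤ r≤s) ⟩
  q + r - r    ≡⟨ p+q-q≡p q r ⟩
  q            ∎
  where open ℚ.≤-Reasoning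

p+q≤r⇒p≤r-q : ∀ {p q r} → p + q ≤ r → p ≤ r - q
p+q≤r⇒p≤r-q {p} {q} {r} p+q≤r = begin
  p            ≡⟨ sym (p+q-q≡p p q) ⟩
  p + q - q    ≤⟨ +-monoˡ-≤ (- q) p+q≤r ⟩
  r - q        ∎
  where open ℚ.≤-Reasoning

p≤p+q-r : ∀ {p q r} → r ≤ q → p ≤ p + q - r
p≤p+q-r {p} {q} {r} r≤q = begin
  p            ≡⟨ sym (p+q-q≡p p r) ⟩
  p + r - r    ≤⟨ +-monoˡ-≤ (- r) (+-monoʳ-≤ p r≤q) ⟩
  p + q - r    ∎
  where open ℚ.≤-Reasoning

*-monoˡ-≤ : ∀ {r p q} → 0ℚ ≤ r → p ≤ q → r * p ≤ r * q
*-monoˡ-≤ {r} 0≤r = ℚ.*-monoˡ-≤-nonNeg r {{ℚ.nonNegative 0≤r}}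

*-monoʳ-≤ : ∀ {r p q} → 0ℚ ≤ r → p ≤ q → p * r ≤ q * r
*-monoʳ-≤ {r} 0≤r = ℚ.*-monoʳ-≤-nonNeg r {{ℚ.nonNegative 0≤r}}

*-mono-≤ : ∀ {a b c d} → 0ℚ ≤ a → a ≤ b → 0ℚ ≤ c → c ≤ d → a * c ≤ b * d
*-mono-≤ 0≤a a≤b 0≤c c≤d = ≤-trans (*-monoˡ-≤ 0≤a c≤d) (*-monoʳ-≤ (≤-trans 0≤c c≤d) a≤b)

*-nonNeg : ∀ {a b} → 0ℚ ≤ a → 0ℚ ≤ b → 0ℚ ≤ a * b
*-nonNeg {a} {b} 0≤a 0≤b = subst (_≤ a * b) (ℚ.*-zeroʳ a) (*-monoˡ-≤ 0≤a 0≤b)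

*-pos : ∀ {a b} → 0ℚ < a → 0ℚ < b → 0ℚ < a * b
*-pos {a} {b} 0<a 0<b = ℚ.positive⁻¹ _ {{ℚ.pos*pos⇒pos a {{ℚ.positive 0<a}} b {{ℚ.positive 0<b}}}}

^-nonNeg : ∀ {r} t → 0ℚ ≤ r → 0ℚ ≤ r ^ t
^-nonNeg zero    0≤r = 0≤1
^-nonNeg (suc t) 0≤r = *-nonNeg 0≤r (^-nonNeg t 0≤r)

^-pos : ∀ {r} t → 0ℚ < r → 0ℚ < r ^ t
^-pos zero    0<r = ℚ.positive⁻¹ 1ℚ
^-pos (suc t) 0<r = *-pos 0<r (^-pos t 0<r)

^≤1 : ∀ {r} t → 0ℚ ≤ r → r ≤ 1ℚ → r ^ t ≤ 1ℚ
^≤1 zero    0≤r r≤1 = ≤-refl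
^≤1 (suc t) 0≤r r≤1 = *-mono-≤ 0≤r r≤1 (^-nonNeg t 0≤r) (^≤1 t 0≤r r≤1)

fromℕ : ℕ → ℚ
fromℕ m = fromℤ (ℤ.+ m)

fromℕ-suc : ∀ m → fromℕ (suc m) ≡ 1ℚ + fromℕ m
fromℕ-suc m = sym (trans (cong (λ k → k ℚ./ 1) (cong (ℤ._+_ (ℤ.+ 1)) (ℤ.*-identityʳ (ℤ.+ m))))
                         (ℚ.normalize-coprime _))

fromℕ-mono-≤ : ∀ {m k} → m ℕ.≤ k → fromℕ m ≤ fromℕ k
fromℕ-mono-≤ {m} {k} m≤k =
  *≤* (subst₂ ℤ._≤_ (ℤ.pos-* m 1) (ℤ.pos-* k 1) (+≤+ (ℕ.*-monoˡ-≤ 1 m≤k)))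

fromℕ-nonNeg : ∀ m → 0ℚ ≤ fromℕ m
fromℕ-nonNeg m = fromℕ-mono-≤ z≤n

1≤fromℕ-fromℕ : ∀ {m k} → m ℕ.< k → 1ℚ ≤ fromℕ k - fromℕ m
1≤fromℕ-fromℕ {m} {k} m<k = p+q≤r⇒p≤r-q {1ℚ} {fromℕ m} {fromℕ k}
  (subst (_≤ fromℕ k) (fromℕ-suc m) (fromℕ-mono-≤ {suc m} {k} m<k))

archimedean : ∀ x → ∃[ T ] x ≤ fromℕ T
archimedean (mkℚ (ℤ.+ a) d _) =
  a , *≤* (subst₂ ℤ._≤_ (ℤ.pos-* a 1) (ℤ.pos-* a (suc d)) (+≤+ (ℕ.*-monoʳ-≤ a (s≤s z≤n))))
archimedean (mkℚ ℤ.-[1+ a ] d _) = 0 , *≤* -≤+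

inv-suc : ∀ m → inv (suc m) ≡ 1/ fromℕ (suc m)
inv-suc m = ℚ.normalize-coprime _

fromℕ*inv : ∀ m → 1 ℕ.≤ m → fromℕ m * inv m ≡ 1ℚ
fromℕ*inv (suc m) _ rewrite inv-suc m = ℚ.*-inverseʳ (fromℕ (suc m))

inv-pos : ∀ m → 1 ℕ.≤ m → 0ℚ < inv m
inv-pos (suc m) _ rewrite inv-suc m = *<* (+<+ (s≤s z≤n))

inv-nonNeg : ∀ m → 0ℚ ≤ inv m
inv-nonNeg zero    = ≤-refl
inv-nonNeg (suc m) = <⇒≤ (inv-pos (suc m) (s≤s z≤n))

inv-antimono : ∀ m k → 1 ℕ.≤ m → m ℕ.≤ k → inv k ≤ inv m
inv-antimono (suc m) (suc k) _ m≤k rewrite inv-suc m | inv-suc k =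
  *≤* (subst₂ ℤ._≤_ (sym (ℤ.*-identityˡ _)) (sym (ℤ.*-identityˡ _)) (+≤+ m≤k))

-- Finite sums and products

∑ : List A → (A → ℚ) → ℚ
∑ xs f = sumℚ (map f xs)

infix 5 ∑
syntax ∑ xs (λ x → e) = ∑[ x ∈ xs ] e

∑-cong : ∀ xs {f g : A → ℚ} → (∀ x → f x ≡ g x) → ∑ xs f ≡ ∑ xs g
∑-cong []       f≗g = refl
∑-cong (x ∷ xs) f≗g = cong₂ _+_ (f≗g x) (∑-cong xs f≗g)

∑-zero : ∀ (xs : List A) → ∑[ x ∈ xs ] 0ℚ ≡ 0ℚ
∑-zero []       = refl
∑-zero (x ∷ xs) = cong (0ℚ +_) (∑-zero xs)

∑-distrib-+ : ∀ xs (f g : A → ℚ) → ∑[ x ∈ xs ] (f x + g x) ≡ ∑ xs f + ∑ xs g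
∑-distrib-+ []       f g = sym (ℚ.+-identityˡ 0ℚ)
∑-distrib-+ (x ∷ xs) f g rewrite ∑-distrib-+ xs f g =
  solve 4 (λ a b c d → (a :+ b) :+ (c :+ d) := (a :+ c) :+ (b :+ d)) refl (f x) (g x) (∑ xs f) (∑ xs g)
  where open +-*-Solver

*-distribˡ-∑ : ∀ a xs (f : A → ℚ) → a * ∑ xs f ≡ ∑[ x ∈ xs ] (a * f x)
*-distribˡ-∑ a []       f = ℚ.*-zeroʳ a
*-distribˡ-∑ a (x ∷ xs) f rewrite sym (*-distribˡ-∑ a xs f) = ℚ.*-distribˡ-+ a (f x) (∑ xs f)

*-distribʳ-∑ : ∀ a xs (f : A → ℚ) → ∑ xs f * a ≡ ∑[ x ∈ xs ] (f x * a)
*-distribʳ-∑ a []       f = ℚ.*-zeroˡ a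
*-distribʳ-∑ a (x ∷ xs) f rewrite sym (*-distribʳ-∑ a xs f) = ℚ.*-distribʳ-+ a (f x) (∑ xs f)

∑-++ : ∀ xs ys (f : A → ℚ) → ∑ (xs ++ ys) f ≡ ∑ xs f + ∑ ys f
∑-++ []       ys f = sym (ℚ.+-identityˡ _)
∑-++ (x ∷ xs) ys f rewrite ∑-++ xs ys f = sym (ℚ.+-assoc (f x) _ _)

∑-map : ∀ (g : A → B) xs (f : B → ℚ) → ∑ (map g xs) f ≡ ∑ xs (f ∘ g)
∑-map g []       f = refl
∑-map g (x ∷ xs) f = cong (f (g x) +_) (∑-map g xs f)

∑-concatMap : ∀ (g : A → List B) xs (f : B → ℚ) → ∑ (concatMap g xs) f ≡ ∑[ x ∈ xs ] ∑ (g x) f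
∑-concatMap g []       f = refl
∑-concatMap g (x ∷ xs) f =
  trans (∑-++ (g x) (concatMap g xs) f) (cong (∑ (g x) f +_) (∑-concatMap g xs f))

∑-comm : ∀ xs ys (f : A → B → ℚ) →
  ∑[ y ∈ ys ] ∑[ x ∈ xs ] f x y ≡ ∑[ x ∈ xs ] ∑[ y ∈ ys ] f x y
∑-comm xs []       f = sym (∑-zero xs)
∑-comm xs (y ∷ ys) f rewrite ∑-comm xs ys f =
  sym (∑-distrib-+ xs (λ x → f x y) (λ x → ∑[ y ∈ ys ] f x y))

∑-mono-≤ : ∀ xs {f g : A → ℚ} → (∀ x → f x ≤ g x) → ∑ xs f ≤ ∑ xs g
∑-mono-≤ []       f≤g = ≤-refl
∑-mono-≤ (x ∷ xs) f≤g = +-mono-≤ (f≤g x) (∑-mono-≤ xs f≤g)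

∑-nonNeg : ∀ xs {f : A → ℚ} → (∀ x → 0ℚ ≤ f x) → 0ℚ ≤ ∑ xs f
∑-nonNeg xs {f} 0≤f = subst (_≤ ∑ xs f) (∑-zero xs) (∑-mono-≤ xs 0≤f)

∈⇒≤∑ : ∀ {xs} {f : A → ℚ} {x} → (∀ y → 0ℚ ≤ f y) → x ∈ xs → f x ≤ ∑ xs f
∈⇒≤∑ {xs = y ∷ xs} {f} 0≤f (here refl) =
  subst (_≤ ∑ (y ∷ xs) f) (ℚ.+-identityʳ (f y)) (+-monoʳ-≤ (f y) (∑-nonNeg xs 0≤f))
∈⇒≤∑ {xs = y ∷ xs} {f} {x} 0≤f (there x∈xs) =
  subst (_≤ ∑ (y ∷ xs) f) (ℚ.+-identityˡ (f x)) (+-mono-≤ (0≤f y) (∈⇒≤∑ 0≤f x∈xs))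

prodFin-suc : ∀ {n} (f : Fin (suc n) → ℚ) → prodFin f ≡ f zero * prodFin (f ∘ suc)
prodFin-suc f = cong (λ fs → f zero * foldr _*_ 1ℚ fs)
  (trans (List.map-tabulate suc f) (sym (List.map-tabulate (λ i → i) (f ∘ suc))))

prodFin-cong : ∀ {n} {f g : Fin n → ℚ} → (∀ i → f i ≡ g i) → prodFin f ≡ prodFin g
prodFin-cong f≗g = cong (foldr _*_ 1ℚ) (List.map-cong f≗g (allFin _))

prodFin-nonNeg : ∀ {n} {f : Fin n → ℚ} → (∀ i → 0ℚ ≤ f i) → 0ℚ ≤ prodFin f
prodFin-nonNeg {zero}      0≤f = 0≤1
prodFin-nonNeg {suc n} {f} 0≤f =
  subst (0ℚ ≤_) (sym (prodFin-suc f)) (*-nonNeg (0≤f zero) (prodFin-nonNeg (0≤f ∘ suc)))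

prodFin-zero : ∀ {n} (f : Fin n → ℚ) i → f i ≡ 0ℚ → prodFin f ≡ 0ℚ
prodFin-zero f zero    fi≡0 =
  trans (prodFin-suc f) (trans (cong (_* prodFin (f ∘ suc)) fi≡0) (ℚ.*-zeroˡ (prodFin (f ∘ suc))))
prodFin-zero f (suc i) fi≡0 =
  trans (prodFin-suc f) (trans (cong (f zero *_) (prodFin-zero (f ∘ suc) i fi≡0)) (ℚ.*-zeroʳ (f zero)))

prodFin-one : ∀ {n} {f : Fin n → ℚ} → (∀ i → f i ≡ 1ℚ) → prodFin f ≡ 1ℚ
prodFin-one {zero}      f≡1 = refl
prodFin-one {suc n} {f} f≡1 = trans (prodFin-suc f) (cong₂ _*_ (f≡1 zero) (prodFin-one (f≡1 ∘ suc)))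

^≤prodFin : ∀ {n r} {f : Fin n → ℚ} → 0ℚ ≤ r → (∀ i → r ≤ f i) → r ^ n ≤ prodFin f
^≤prodFin {zero}          0≤r r≤f = ≤-refl
^≤prodFin {suc n} {r} {f} 0≤r r≤f = subst (r ^ suc n ≤_) (sym (prodFin-suc f))
  (*-mono-≤ 0≤r (r≤f zero) (^-nonNeg n 0≤r) (^≤prodFin 0≤r (r≤f ∘ suc)))

prodFin-indicator : ∀ {n} (p : Fin n → Bool) →
  prodFin (λ i → if p i then 1ℚ else 0ℚ) ≡ (if all p (allFin n) then 1ℚ else 0ℚ)
prodFin-indicator {n} p = go (allFin n)
  where
  go : ∀ is → foldr _*_ 1ℚ (map (λ i → if p i then 1ℚ else 0ℚ) is) ≡ (if all p is then 1ℚ else 0ℚ)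
  go []       = refl
  go (i ∷ is) with p i
  ... | true  = trans (ℚ.*-identityˡ _) (go is)
  ... | false = ℚ.*-zeroˡ (foldr _*_ 1ℚ (map (λ i → if p i then 1ℚ else 0ℚ) is))

-- Counting

≡⇒==ᶠ : ∀ {q} {a b : Fin q} → a ≡ b → T (a ==ᶠ b)
≡⇒==ᶠ {a = a} {b} = fromWitness {a? = a ≟ b}

==ᶠ⇒≡ : ∀ {q} {a b : Fin q} → T (a ==ᶠ b) → a ≡ b
==ᶠ⇒≡ {a = a} {b} = toWitness {a? = a ≟ b}

≢⇒not==ᶠ : ∀ {q} {a b : Fin q} → a ≢ b → T (not (a ==ᶠ b))
≢⇒not==ᶠ {a = a} {b} = fromWitnessFalse {a? = a ≟ b}

not==ᶠ⇒≢ : ∀ {q} {a b : Fin q} → T (not (a ==ᶠ b)) → a ≢ b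
not==ᶠ⇒≢ {a = a} {b} = toWitnessFalse {a? = a ≟ b}

==ᶠ-sym : ∀ {q} (a b : Fin q) → (a ==ᶠ b) ≡ (b ==ᶠ a)
==ᶠ-sym a b with a ≟ b | b ≟ a
... | yes _   | yes _   = refl
... | no  _   | no  _   = refl
... | yes a≡b | no  b≢a = ⊥-elim (b≢a (sym a≡b))
... | no  a≢b | yes b≡a = ⊥-elim (a≢b (sym b≡a))

count : (A → Bool) → List A → ℕ
count p xs = length (filter (λ x → T? (p x)) xs)

count-false : ∀ (xs : List A) → count (λ _ → false) xs ≡ 0
count-false []       = refl
count-false (x ∷ xs) = count-false xs

count-allFin≤ : ∀ {q} (p : Fin q → Bool) → count p (allFin q) ℕ.≤ q
count-allFin≤ {q} p = ℕ.≤-trans (List.length-filter (λ k → T? (p k)) (allFin q))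
                                (ℕ.≤-reflexive (List.length-tabulate (λ k → k)))

count-cong : ∀ {p r : A → Bool} xs → (∀ x → p x ≡ r x) → count p xs ≡ count r xs
count-cong []                   p≗r = refl
count-cong {p = p} {r} (x ∷ xs) p≗r with p x | r x | p≗r x
... | true  | true  | refl = cong suc (count-cong xs p≗r)
... | false | false | refl = count-cong xs p≗r

count-map : ∀ (p : B → Bool) (f : A → B) xs → count p (map f xs) ≡ count (p ∘ f) xs
count-map p f []       = refl
count-map p f (x ∷ xs) with p (f x)
... | true  = cong suc (count-map p f xs)
... | false = count-map p f xs

count-complement : ∀ (p : A → Bool) xs → count p xs ℕ.+ count (not ∘ p) xs ≡ length xs
count-complement p []       = refl
count-complement p (x ∷ xs) with p x
... | true  = cong suc (count-complement p xs)
... | false = trans (ℕ.+-suc _ _) (cong suc (count-complement p xs))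

count-∨ : ∀ (p r : A → Bool) xs → count (λ x → p x ∨ r x) xs ℕ.≤ count p xs ℕ.+ count r xs
count-∨ p r []       = z≤n
count-∨ p r (x ∷ xs) with p x | r x | count-∨ p r xs
... | true  | true  | ih = s≤s (ℕ.≤-trans ih (ℕ.+-monoʳ-≤ (count p xs) (ℕ.n≤1+n _)))
... | true  | false | ih = s≤s ih
... | false | true  | ih = ℕ.≤-trans (s≤s ih) (ℕ.≤-reflexive (sym (ℕ.+-suc (count p xs) _)))
... | false | false | ih = ih

count-mono : ∀ {p r : A → Bool} xs → (∀ x → T (p x) → T (r x)) → count p xs ℕ.≤ count r xs
count-mono []                   p⇒r = z≤n
count-mono {p = p} {r} (x ∷ xs) p⇒r with p x | r x | p⇒r x | count-mono xs p⇒r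
... | true  | true  | _     | ih = s≤s ih
... | true  | false | px⇒rx | _  = ⊥-elim (px⇒rx tt)
... | false | true  | _     | ih = ℕ.m≤n⇒m≤1+n ih
... | false | false | _     | ih = ih

count-mono-< : ∀ {p r : A → Bool} {x₀ xs} → (∀ x → T (p x) → T (r x)) →
  x₀ ∈ xs → T (r x₀) → ¬ T (p x₀) → count p xs ℕ.< count r xs
count-mono-< {p = p} {r} {xs = x ∷ xs} p⇒r (here refl) rx₀ ¬px₀ with p x | r x
... | true  | _    = ⊥-elim (¬px₀ tt)
... | false | true = s≤s (count-mono xs p⇒r)
count-mono-< {p = p} {r} {xs = x ∷ xs} p⇒r (there x₀∈xs) rx₀ ¬px₀ with p x | r x | p⇒r x
... | true  | true  | _     = s≤s (count-mono-< p⇒r x₀∈xs rx₀ ¬px₀)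
... | true  | false | px⇒rx = ⊥-elim (px⇒rx tt)
... | false | true  | _     = ℕ.m≤n⇒m≤1+n (count-mono-< p⇒r x₀∈xs rx₀ ¬px₀)
... | false | false | _     = count-mono-< p⇒r x₀∈xs rx₀ ¬px₀

count-witness : ∀ (p : A → Bool) xs → 1 ℕ.≤ count p xs → ∃[ x ] x ∈ xs × T (p x)
count-witness p (x ∷ xs) 1≤count with p x in px
... | true  = x , here refl , subst T (sym px) tt
... | false with count-witness p xs 1≤count
...   | y , y∈xs , py = y , there y∈xs , py

count-not-all : ∀ (p : A → Bool) xs → T (not (all p xs)) → 1 ℕ.≤ count (not ∘ p) xs
count-not-all p (x ∷ xs) h with p x
... | true  = count-not-all p xs h
... | false = s≤s z≤n

count-tabulate-suc : ∀ {q} (p : Fin (suc q) → Bool) → count p (tabulate suc) ≡ count (p ∘ suc) (allFin q)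
count-tabulate-suc {q} p =
  trans (cong (count p) (sym (List.map-tabulate (λ i → i) suc))) (count-map p suc (allFin q))

count-==ᶠ : ∀ {q} (a : Fin q) → count (a ==ᶠ_) (allFin q) ≡ 1
count-==ᶠ {suc q} zero    = cong suc (trans (count-tabulate-suc {q} (zero ==ᶠ_)) (count-false (allFin q)))
count-==ᶠ {suc q} (suc a) = begin
  count (suc a ==ᶠ_) (tabulate suc)         ≡⟨ count-tabulate-suc (suc a ==ᶠ_) ⟩
  count (λ k → suc a ==ᶠ suc k) (allFin q)  ≡⟨ count-cong (allFin q) suc==ᶠsuc ⟩
  count (a ==ᶠ_) (allFin q)                 ≡⟨ count-==ᶠ a ⟩
  1                                         ∎
  where
  open ≡-Reasoning
  suc==ᶠsuc : ∀ k → (suc a ==ᶠ suc k) ≡ (a ==ᶠ k)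
  suc==ᶠsuc k = ⌊⌋-map′ (cong suc) suc-injective (a ≟ k)

count-image : ∀ {q} (p : A → Bool) (f : A → Fin q) xs →
  count (λ k → any (λ x → p x ∧ (f x ==ᶠ k)) xs) (allFin q) ℕ.≤ count p xs
count-image {q = q} p f []       = ℕ.≤-reflexive (count-false (allFin q))
count-image {q = q} p f (x ∷ xs) with p x | count-image p f xs
... | true  | ih = ℕ.≤-trans (count-∨ _ _ (allFin q)) (ℕ.+-mono-≤ (ℕ.≤-reflexive (count-==ᶠ (f x))) ih)
... | false | ih =
  ℕ.≤-trans (count-∨ _ _ (allFin q)) (ℕ.+-mono-≤ (ℕ.≤-reflexive (count-false (allFin q))) ih)

∃-satisfier-≢ : ∀ {q} (p : Fin q → Bool) → 2 ℕ.≤ count p (allFin q) →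
  ∀ a → ∃[ b ] T (p b) × b ≢ a
∃-satisfier-≢ {q} p 2≤count a = conclude (count-witness p′ (allFin q) 1≤count′)
  where
  p′ : Fin q → Bool
  p′ b = p b ∧ not (a ==ᶠ b)
  split : ∀ b → T (p b) → T (p′ b ∨ (a ==ᶠ b))
  split b pb with p b | a ==ᶠ b
  ... | true | true  = tt
  ... | true | false = tt
  1≤count′ : 1 ℕ.≤ count p′ (allFin q)
  1≤count′ = ℕ.+-cancelʳ-≤ 1 1 _ (begin
    2                                                  ≤⟨ 2≤count ⟩
    count p (allFin q)                                 ≤⟨ count-mono (allFin q) split ⟩
    count (λ b → p′ b ∨ (a ==ᶠ b)) (allFin q)          ≤⟨ count-∨ p′ (a ==ᶠ_) (allFin q) ⟩
    count p′ (allFin q) ℕ.+ count (a ==ᶠ_) (allFin q)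
      ≡⟨ cong (count p′ (allFin q) ℕ.+_) (count-==ᶠ a) ⟩
    count p′ (allFin q) ℕ.+ 1                          ∎)
    where open ℕ.≤-Reasoning
  conclude : ∃[ b ] b ∈ allFin q × T (p′ b) → ∃[ b ] T (p b) × b ≢ a
  conclude (b , _ , p′b) = b , proj₁ pb×a≢b , λ b≡a → not==ᶠ⇒≢ (proj₂ pb×a≢b) (sym b≡a)
    where
    pb×a≢b : T (p b) × T (not (a ==ᶠ b))
    pb×a≢b = Equivalence.to (T-∧ {p b}) p′b

∑-indicator : ∀ (p : A → Bool) r xs → ∑[ x ∈ xs ] (if p x then r else 0ℚ) ≡ fromℕ (count p xs) * r
∑-indicator p r []       = sym (ℚ.*-zeroˡ r)
∑-indicator p r (x ∷ xs) with p x
... | true  = begin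
  r + (∑[ x ∈ xs ] (if p x then r else 0ℚ))
    ≡⟨ cong₂ _+_ (sym (ℚ.*-identityˡ r)) (∑-indicator p r xs) ⟩
  1ℚ * r + fromℕ (count p xs) * r            ≡⟨ sym (ℚ.*-distribʳ-+ r 1ℚ (fromℕ (count p xs))) ⟩
  (1ℚ + fromℕ (count p xs)) * r              ≡⟨ cong (_* r) (sym (fromℕ-suc (count p xs))) ⟩
  fromℕ (suc (count p xs)) * r               ∎
  where open ≡-Reasoning
... | false = trans (ℚ.+-identityˡ _) (∑-indicator p r xs)

∑-==ᶠ : ∀ {q} (a : Fin q) → ∑[ k ∈ allFin q ] (if k ==ᶠ a then 1ℚ else 0ℚ) ≡ 1ℚ
∑-==ᶠ {q} a = begin
  ∑[ k ∈ allFin q ] (if k ==ᶠ a then 1ℚ else 0ℚ)  ≡⟨ ∑-indicator (_==ᶠ a) 1ℚ (allFin q) ⟩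
  fromℕ (count (_==ᶠ a) (allFin q)) * 1ℚ          ≡⟨ cong (λ m → fromℕ m * 1ℚ) count≡1 ⟩
  1ℚ * 1ℚ                                          ≡⟨⟩
  1ℚ                                               ∎
  where
  open ≡-Reasoning
  count≡1 : count (_==ᶠ a) (allFin q) ≡ 1
  count≡1 = trans (count-cong (allFin q) (λ k → ==ᶠ-sym k a)) (count-==ᶠ a)

-- A drift criterion for finite Markov chains

bernoulli : ∀ {δ} → 0ℚ ≤ δ → δ ≤ 1ℚ → ∀ t → (1ℚ - δ) ^ t * (1ℚ + fromℕ t * δ) ≤ 1ℚ
bernoulli {δ} 0≤δ δ≤1 zero =
  ≤-reflexive (solve 1 (λ d → con 1ℚ :* (con 1ℚ :+ con 0ℚ :* d) := con 1ℚ) refl δ)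
  where open +-*-Solver
bernoulli {δ} 0≤δ δ≤1 (suc t) = begin
  (1ℚ - δ) ^ suc t * (1ℚ + fromℕ (suc t) * δ)
    ≡⟨ cong (λ x → (1ℚ - δ) ^ suc t * (1ℚ + x * δ)) (fromℕ-suc t) ⟩
  ((1ℚ - δ) * ρᵗ) * (1ℚ + (1ℚ + fromℕ t) * δ)
    ≡⟨ solve 3 (λ d r t → ((con 1ℚ :- d) :* r) :* (con 1ℚ :+ (con 1ℚ :+ t) :* d)
                        := r :* (con 1ℚ :+ t :* d) :- r :* (d :* (t :* d :+ d))) refl δ ρᵗ (fromℕ t) ⟩
  ρᵗ * (1ℚ + fromℕ t * δ) - ρᵗ * (δ * (fromℕ t * δ + δ))
    ≤⟨ p-q≤p (*-nonNeg 0≤ρᵗ (*-nonNeg 0≤δ (+-mono-≤ (*-nonNeg (fromℕ-nonNeg t) 0≤δ) 0≤δ))) ⟩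
  ρᵗ * (1ℚ + fromℕ t * δ)
    ≤⟨ bernoulli 0≤δ δ≤1 t ⟩
  1ℚ ∎
  where
  open ℚ.≤-Reasoning
  open +-*-Solver
  ρᵗ = (1ℚ - δ) ^ t
  0≤ρᵗ : 0ℚ ≤ ρᵗ
  0≤ρᵗ = ^-nonNeg t (p≤q⇒0≤q-p δ≤1)

geometric-decay : ∀ {δ ε} a → 0ℚ < δ → δ ≤ 1ℚ → 0ℚ < ε →
  ∃[ T₀ ] (∀ t → T₀ ℕ.≤ t → (1ℚ - δ) ^ t * a ≤ ε)
geometric-decay {δ} {ε} a 0<δ δ≤1 0<ε = T₀ , bound
  where
  0<εδ : 0ℚ < ε * δ
  0<εδ = *-pos 0<ε 0<δ
  instance
    εδ≢0 : ℚ.NonZero (ε * δ)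
    εδ≢0 = ℚ.>-nonZero 0<εδ
  T₀ : ℕ
  T₀ = proj₁ (archimedean (a * 1/ (ε * δ)))
  a≤T₀εδ : a ≤ fromℕ T₀ * (ε * δ)
  a≤T₀εδ = begin
    a                          ≡⟨ sym (trans (ℚ.*-assoc a _ _) (trans (cong (a *_) (ℚ.*-inverseˡ (ε * δ)))
                                                                       (ℚ.*-identityʳ a))) ⟩
    a * 1/ (ε * δ) * (ε * δ)   ≤⟨ *-monoʳ-≤ (<⇒≤ 0<εδ) (proj₂ (archimedean (a * 1/ (ε * δ)))) ⟩
    fromℕ T₀ * (ε * δ)         ∎
    where open ℚ.≤-Reasoning
  bound : ∀ t → T₀ ℕ.≤ t → (1ℚ - δ) ^ t * a ≤ ε
  bound t T₀≤t = begin
    ρᵗ * a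
      ≤⟨ *-monoˡ-≤ 0≤ρᵗ (≤-trans a≤T₀εδ (*-monoʳ-≤ (<⇒≤ 0<εδ) (fromℕ-mono-≤ T₀≤t))) ⟩
    ρᵗ * (fromℕ t * (ε * δ))
      ≡⟨ solve 4 (λ r t e d → r :* (t :* (e :* d)) := e :* (r :* (t :* d))) refl ρᵗ (fromℕ t) ε δ ⟩
    ε * (ρᵗ * (fromℕ t * δ))
      ≤⟨ *-monoˡ-≤ (<⇒≤ 0<ε) (*-monoˡ-≤ 0≤ρᵗ x≤1+x) ⟩
    ε * (ρᵗ * (1ℚ + fromℕ t * δ))
      ≤⟨ *-monoˡ-≤ (<⇒≤ 0<ε) (bernoulli (<⇒≤ 0<δ) δ≤1 t) ⟩
    ε * 1ℚ
      ≡⟨ ℚ.*-identityʳ ε ⟩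
    ε ∎
    where
    open ℚ.≤-Reasoning
    open +-*-Solver
    ρᵗ = (1ℚ - δ) ^ t
    0≤ρᵗ : 0ℚ ≤ ρᵗ
    0≤ρᵗ = ^-nonNeg t (p≤q⇒0≤q-p δ≤1)
    x≤1+x : fromℕ t * δ ≤ 1ℚ + fromℕ t * δ
    x≤1+x = ≤-trans (≤-reflexive (sym (ℚ.+-identityˡ (fromℕ t * δ)))) (+-monoˡ-≤ (fromℕ t * δ) 0≤1)

module Lyapunov
  {X : Set} (xs : List X) (P : X → X → ℚ)
  (P-nonNeg : ∀ x y → 0ℚ ≤ P x y) (P-stochastic : ∀ x → ∑[ y ∈ xs ] P x y ≡ 1ℚ)
  (u : X → ℚ) (good : X → Bool) {δ N : ℚ}
  (0≤u : ∀ x → 0ℚ ≤ u x) (u≤N : ∀ x → u x ≤ N) (1≤u : ∀ x → T (not (good x)) → 1ℚ ≤ u x)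
  (0<δ : 0ℚ < δ) (δ≤1 : δ ≤ 1ℚ) (drift : ∀ x → ∑[ y ∈ xs ] P x y * u y ≤ (1ℚ - δ) * u x)
  where

  evolve : (X → ℚ) → X → ℚ
  evolve μ y = ∑[ x ∈ xs ] μ x * P x y

  𝔼 : (X → ℚ) → ℚ
  𝔼 μ = ∑[ x ∈ xs ] μ x * u x

  ℙ-good : (X → ℚ) → ℚ
  ℙ-good μ = ∑[ x ∈ xs ] (if good x then μ x else 0ℚ)

  evolve-nonNeg : ∀ {μ} → (∀ x → 0ℚ ≤ μ x) → ∀ y → 0ℚ ≤ evolve μ y
  evolve-nonNeg 0≤μ y = ∑-nonNeg xs (λ x → *-nonNeg (0≤μ x) (P-nonNeg x y))

  evolve-mass : ∀ μ → ∑ xs (evolve μ) ≡ ∑ xs μ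
  evolve-mass μ = begin
    ∑[ y ∈ xs ] ∑[ x ∈ xs ] μ x * P x y
      ≡⟨ ∑-comm xs xs (λ x y → μ x * P x y) ⟩
    ∑[ x ∈ xs ] ∑[ y ∈ xs ] μ x * P x y
      ≡⟨ ∑-cong xs (λ x → sym (*-distribˡ-∑ (μ x) xs (P x))) ⟩
    ∑[ x ∈ xs ] μ x * (∑[ y ∈ xs ] P x y)
      ≡⟨ ∑-cong xs (λ x → cong (μ x *_) (P-stochastic x)) ⟩
    ∑[ x ∈ xs ] μ x * 1ℚ
      ≡⟨ ∑-cong xs (λ x → ℚ.*-identityʳ (μ x)) ⟩
    ∑ xs μ ∎
    where open ≡-Reasoning

  𝔼-evolve : ∀ {μ} → (∀ x → 0ℚ ≤ μ x) → 𝔼 (evolve μ) ≤ (1ℚ - δ) * 𝔼 μ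
  𝔼-evolve {μ} 0≤μ = begin
    ∑[ y ∈ xs ] (∑[ x ∈ xs ] μ x * P x y) * u y
      ≡⟨ ∑-cong xs (λ y → *-distribʳ-∑ (u y) xs (λ x → μ x * P x y)) ⟩
    ∑[ y ∈ xs ] ∑[ x ∈ xs ] μ x * P x y * u y
      ≡⟨ ∑-comm xs xs (λ x y → μ x * P x y * u y) ⟩
    ∑[ x ∈ xs ] ∑[ y ∈ xs ] μ x * P x y * u y
      ≡⟨ ∑-cong xs (λ x → trans (∑-cong xs (λ y → ℚ.*-assoc (μ x) (P x y) (u y)))
                                (sym (*-distribˡ-∑ (μ x) xs (λ y → P x y * u y)))) ⟩
    ∑[ x ∈ xs ] μ x * (∑[ y ∈ xs ] P x y * u y)
      ≤⟨ ∑-mono-≤ xs (λ x → *-monoˡ-≤ (0≤μ x) (drift x)) ⟩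
    ∑[ x ∈ xs ] μ x * ((1ℚ - δ) * u x)
      ≡⟨ ∑-cong xs (λ x → solve 3 (λ m r v → m :* (r :* v) := r :* (m :* v)) refl
                                  (μ x) (1ℚ - δ) (u x)) ⟩
    ∑[ x ∈ xs ] (1ℚ - δ) * (μ x * u x)
      ≡⟨ sym (*-distribˡ-∑ (1ℚ - δ) xs (λ x → μ x * u x)) ⟩
    (1ℚ - δ) * 𝔼 μ ∎
    where
    open ℚ.≤-Reasoning
    open +-*-Solver

  module _ (μ : ℕ → X → ℚ) (μ-suc : ∀ t y → μ (suc t) y ≡ evolve (μ t) y)
           (0≤μ₀ : ∀ x → 0ℚ ≤ μ 0 x) (μ₀-mass : ∑ xs (μ 0) ≡ 1ℚ) where

    0≤μ : ∀ t x → 0ℚ ≤ μ t x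
    0≤μ zero      = 0≤μ₀
    0≤μ (suc t) y = subst (0ℚ ≤_) (sym (μ-suc t y)) (evolve-nonNeg (0≤μ t) y)

    μ-mass : ∀ t → ∑ xs (μ t) ≡ 1ℚ
    μ-mass zero    = μ₀-mass
    μ-mass (suc t) = trans (∑-cong xs (μ-suc t)) (trans (evolve-mass (μ t)) (μ-mass t))

    𝔼-bound : ∀ t → 𝔼 (μ t) ≤ (1ℚ - δ) ^ t * N
    𝔼-bound zero = begin
      ∑[ x ∈ xs ] μ 0 x * u x  ≤⟨ ∑-mono-≤ xs (λ x → *-monoˡ-≤ (0≤μ₀ x) (u≤N x)) ⟩
      ∑[ x ∈ xs ] μ 0 x * N    ≡⟨ sym (*-distribʳ-∑ N xs (μ 0)) ⟩
      ∑ xs (μ 0) * N           ≡⟨ cong (_* N) μ₀-mass ⟩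
      1ℚ * N                   ∎
      where open ℚ.≤-Reasoning
    𝔼-bound (suc t) = begin
      𝔼 (μ (suc t))                  ≡⟨ ∑-cong xs (λ y → cong (_* u y) (μ-suc t y)) ⟩
      𝔼 (evolve (μ t))               ≤⟨ 𝔼-evolve (0≤μ t) ⟩
      (1ℚ - δ) * 𝔼 (μ t)             ≤⟨ *-monoˡ-≤ (p≤q⇒0≤q-p δ≤1) (𝔼-bound t) ⟩
      (1ℚ - δ) * ((1ℚ - δ) ^ t * N)  ≡⟨ sym (ℚ.*-assoc (1ℚ - δ) _ N) ⟩
      (1ℚ - δ) ^ suc t * N           ∎
      where open ℚ.≤-Reasoning

    1≤ℙ-good+𝔼 : ∀ t → 1ℚ ≤ ℙ-good (μ t) + 𝔼 (μ t)
    1≤ℙ-good+𝔼 t = begin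
      1ℚ                                                          ≡⟨ sym (μ-mass t) ⟩
      ∑ xs (μ t)                                                  ≤⟨ ∑-mono-≤ xs pointwise ⟩
      ∑[ x ∈ xs ] ((if good x then μ t x else 0ℚ) + μ t x * u x)
        ≡⟨ ∑-distrib-+ xs (λ x → if good x then μ t x else 0ℚ) (λ x → μ t x * u x) ⟩
      ℙ-good (μ t) + 𝔼 (μ t)                                      ∎
      where
      open ℚ.≤-Reasoning
      pointwise : ∀ x → μ t x ≤ (if good x then μ t x else 0ℚ) + μ t x * u x
      pointwise x with T-or-T-not (good x)
      ... | inj₁ good-x = begin
        μ t x                                         ≡⟨ sym (ℚ.+-identityʳ (μ t x)) ⟩
        μ t x + 0ℚ
          ≤⟨ +-mono-≤ (≤-reflexive (sym (if-T good-x))) (*-nonNeg (0≤μ t x) (0≤u x)) ⟩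
        (if good x then μ t x else 0ℚ) + μ t x * u x  ∎
      ... | inj₂ bad-x = begin
        μ t x                                         ≡⟨ sym (ℚ.*-identityʳ (μ t x)) ⟩
        μ t x * 1ℚ                                    ≡⟨ sym (ℚ.+-identityˡ (μ t x * 1ℚ)) ⟩
        0ℚ + μ t x * 1ℚ
          ≤⟨ +-mono-≤ (≤-reflexive (sym (if-F bad-x))) (*-monoˡ-≤ (0≤μ t x) (1≤u x bad-x)) ⟩
        (if good x then μ t x else 0ℚ) + μ t x * u x  ∎

    eventually-good : ∀ {ε} → 0ℚ < ε → ∃[ T₀ ] (∀ t → T₀ ℕ.≤ t → 1ℚ - ε ≤ ℙ-good (μ t))
    eventually-good {ε} 0<ε =
      proj₁ decay , λ t T₀≤t → 1-ε≤ℙ-good t (≤-trans (𝔼-bound t) (proj₂ decay t T₀≤t))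
      where
      decay : ∃[ T₀ ] (∀ t → T₀ ℕ.≤ t → (1ℚ - δ) ^ t * N ≤ ε)
      decay = geometric-decay N 0<δ δ≤1 0<ε
      1-ε≤ℙ-good : ∀ t → 𝔼 (μ t) ≤ ε → 1ℚ - ε ≤ ℙ-good (μ t)
      1-ε≤ℙ-good t 𝔼≤ε = p≤q+r⇒p-s≤q 𝔼≤ε (1≤ℙ-good+𝔼 t)

-- Colourings

∑-allColorings-prodFin : ∀ n q (w : Fin n → Fin q → ℚ) →
  ∑[ c ∈ allColorings n q ] prodFin (λ i → w i (c i)) ≡ prodFin (λ i → ∑ (allFin q) (w i))
∑-allColorings-prodFin zero    q w = ℚ.+-identityʳ 1ℚ
∑-allColorings-prodFin (suc n) q w = begin
  ∑ (concatMap extensions (allFin q)) F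
    ≡⟨ ∑-concatMap extensions (allFin q) F ⟩
  ∑[ k ∈ allFin q ] ∑ (extensions k) F
    ≡⟨ ∑-cong (allFin q) (λ k → ∑-map (k Vector.∷_) (allColorings n q) F) ⟩
  ∑[ k ∈ allFin q ] ∑[ c ∈ allColorings n q ] F (k Vector.∷ c)
    ≡⟨ ∑-cong (allFin q) (λ k → ∑-cong (allColorings n q) (λ c →
         prodFin-suc (λ i → w i ((k Vector.∷ c) i)))) ⟩
  ∑[ k ∈ allFin q ] ∑[ c ∈ allColorings n q ] (w zero k * F′ c)
    ≡⟨ ∑-cong (allFin q) (λ k → sym (*-distribˡ-∑ (w zero k) (allColorings n q) F′)) ⟩
  ∑[ k ∈ allFin q ] (w zero k * ∑ (allColorings n q) F′)
    ≡⟨ ∑-cong (allFin q) (λ k → cong (w zero k *_) (∑-allColorings-prodFin n q (w ∘ suc))) ⟩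
  ∑[ k ∈ allFin q ] (w zero k * prodFin (λ i → ∑ (allFin q) (w (suc i))))
    ≡⟨ sym (*-distribʳ-∑ _ (allFin q) (w zero)) ⟩
  ∑ (allFin q) (w zero) * prodFin (λ i → ∑ (allFin q) (w (suc i)))
    ≡⟨ sym (prodFin-suc (λ i → ∑ (allFin q) (w i))) ⟩
  prodFin (λ i → ∑ (allFin q) (w i)) ∎
  where
  open ≡-Reasoning
  extensions : Fin q → List (Coloring (suc n) q)
  extensions k = map (k Vector.∷_) (allColorings n q)
  F : Coloring (suc n) q → ℚ
  F c = prodFin (λ i → w i (c i))
  F′ : Coloring n q → ℚ
  F′ c = prodFin (λ i → w (suc i) (c i))

allColorings-complete : ∀ n q (c : Coloring n q) → ∃[ c' ] c' ∈ allColorings n q × (∀ i → c' i ≡ c i)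
allColorings-complete zero    q c = (λ ()) , here refl , λ ()
allColorings-complete (suc n) q c with allColorings-complete n q (c ∘ suc)
... | c' , c'∈ , c'≗c = c zero Vector.∷ c'
  , ∈-concatMap⁺ _ (lose (∈-allFin (c zero)) (∈-map⁺ (c zero Vector.∷_) c'∈))
  , λ { zero → refl ; (suc i) → c'≗c i }

point-mass-nonNeg : ∀ {n q} (c₀ c : Coloring n q) → 0ℚ ≤ (if c ==ᶜ c₀ then 1ℚ else 0ℚ)
point-mass-nonNeg c₀ c = if-nonNeg (c ==ᶜ c₀) 0≤1 ≤-refl

∑-point-mass : ∀ {n q} (c₀ : Coloring n q) →
  ∑[ c ∈ allColorings n q ] (if c ==ᶜ c₀ then 1ℚ else 0ℚ) ≡ 1ℚ
∑-point-mass {n} {q} c₀ = begin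
  ∑[ c ∈ allColorings n q ] (if c ==ᶜ c₀ then 1ℚ else 0ℚ)
    ≡⟨ ∑-cong (allColorings n q) (λ c → sym (prodFin-indicator (λ i → c i ==ᶠ c₀ i))) ⟩
  ∑[ c ∈ allColorings n q ] prodFin (λ i → if c i ==ᶠ c₀ i then 1ℚ else 0ℚ)
    ≡⟨ ∑-allColorings-prodFin n q (λ i k → if k ==ᶠ c₀ i then 1ℚ else 0ℚ) ⟩
  prodFin (λ i → ∑[ k ∈ allFin q ] (if k ==ᶠ c₀ i then 1ℚ else 0ℚ))
    ≡⟨ prodFin-one (λ i → ∑-==ᶠ (c₀ i)) ⟩
  1ℚ ∎
  where open ≡-Reasoning

∈⇒≤max : ∀ (f : A → ℕ) {x xs} → x ∈ xs → f x ℕ.≤ foldr ℕ._⊔_ 0 (map f xs)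
∈⇒≤max f {xs = y ∷ xs} (here refl)  = ℕ.m≤m⊔n (f y) _
∈⇒≤max f {xs = y ∷ xs} (there x∈xs) = ℕ.≤-trans (∈⇒≤max f x∈xs) (ℕ.m≤n⊔m (f y) _)

degree≤maxDegree : ∀ {n} (G : Graph n) i → degree G i ℕ.≤ maxDegree G
degree≤maxDegree G i = ∈⇒≤max (degree G) (∈-allFin i)

-- The greedy and selfish dynamics

module Dynamics {n q : ℕ} (G : Graph n) where

  free : Coloring n q → Fin n → Fin q → Bool
  free c i k = not (usedByNbr G c i k)

  usedByNbr⁺ : ∀ {c : Coloring n q} {i j k} → T (adj G i j) → c j ≡ k → T (usedByNbr G c i k)
  usedByNbr⁺ {c} {i} {j} {k} ij cj≡k =
    any⁺ (λ l → adj G i l ∧ (c l ==ᶠ k)) (lose (∈-allFin j) (Equivalence.from T-∧ (ij , ≡⇒==ᶠ cj≡k)))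

  usedByNbr⁻ : ∀ {c : Coloring n q} {i k} → T (usedByNbr G c i k) → ∃[ j ] T (adj G i j) × c j ≡ k
  usedByNbr⁻ {c} {i} {k} used with find (any⁻ (λ l → adj G i l ∧ (c l ==ᶠ k)) (allFin n) used)
  ... | j , _ , ij∧cj≡k with Equivalence.to (T-∧ {adj G i j}) ij∧cj≡k
  ...   | ij , cj≡k = j , ij , ==ᶠ⇒≡ cj≡k

  playerProb-happy : ∀ {c : Coloring n q} {i k} → T (payoff G c i) →
    playerProb G c i k ≡ (if k ==ᶠ c i then 1ℚ else 0ℚ)
  playerProb-happy = if-T

  playerProb-unhappy : ∀ {c : Coloring n q} {i k} → T (not (payoff G c i)) →
    playerProb G c i k ≡ (if usedByNbr G c i k then 0ℚ else inv (nAvailable G c i))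
  playerProb-unhappy = if-F

  playerProb-nonNeg : ∀ (c : Coloring n q) i k → 0ℚ ≤ playerProb G c i k
  playerProb-nonNeg c i k =
    if-nonNeg (payoff G c i) (if-nonNeg (k ==ᶠ c i) 0≤1 ≤-refl)
                             (if-nonNeg (usedByNbr G c i k) ≤-refl (inv-nonNeg (nAvailable G c i)))

  playerProb-blocked : ∀ {c : Coloring n q} {j k} → T (usedByNbr G c j k) → k ≢ c j →
    playerProb G c j k ≡ 0ℚ
  playerProb-blocked {c} {j} {k} used moved with T-or-T-not (payoff G c j)
  ... | inj₁ happy   = trans (playerProb-happy happy) (if-F (≢⇒not==ᶠ moved))
  ... | inj₂ unhappy = trans (playerProb-unhappy unhappy) (if-T used)

  step-nonNeg : ∀ (c c' : Coloring n q) → 0ℚ ≤ step G c c'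
  step-nonNeg c c' = prodFin-nonNeg (λ i → playerProb-nonNeg c i (c' i))

  step-zero : ∀ {c c' : Coloring n q} i → playerProb G c i (c' i) ≡ 0ℚ → step G c c' ≡ 0ℚ
  step-zero i = prodFin-zero _ i

  step-resp : ∀ {c c' c'' : Coloring n q} → (∀ j → c' j ≡ c'' j) → step G c c' ≡ step G c c''
  step-resp {c} {c'} {c''} c'≗c'' =
    prodFin-cong {f = λ i → playerProb G c i (c' i)} {g = λ i → playerProb G c i (c'' i)}
                 (λ i → cong (playerProb G c i) (c'≗c'' i))

  happy-stays-happy : ∀ {c c' : Coloring n q} {i} → step G c c' ≢ 0ℚ → T (payoff G c i) → T (payoff G c' i)
  happy-stays-happy {c} {c'} {i} step≢0 happy with c' i ≟ c i
  ... | no moved =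
    ⊥-elim (step≢0 (step-zero i (trans (playerProb-happy happy) (if-F (≢⇒not==ᶠ moved)))))
  ... | yes stayed with T-or-T-not (usedByNbr G c' i (c' i))
  ...   | inj₂ no-clash = no-clash
  ...   | inj₁ clash with usedByNbr⁻ clash
  ...     | j , ij , c'j≡c'i = ⊥-elim (step≢0 (step-zero j (playerProb-blocked j-blocked j-moved)))
    where
    c'j≡ci : c' j ≡ c i
    c'j≡ci = trans c'j≡c'i stayed
    j-blocked : T (usedByNbr G c j (c' j))
    j-blocked = usedByNbr⁺ (subst T (Graph.sym G i j) ij) (sym c'j≡ci)
    j-moved : c' j ≢ c j
    j-moved c'j≡cj = T-not-¬ happy (usedByNbr⁺ ij (trans (sym c'j≡cj) c'j≡ci))

  proper-happy : ∀ {c : Coloring n q} → T (proper G c) → ∀ i → T (payoff G c i)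
  proper-happy {c} h i = All.lookup (all⁺ (payoff G c) (allFin n) h) (∈-allFin i)

  proper-absorbing : ∀ {c : Coloring n q} → T (proper G c) →
    ∀ c' → step G c c' ≡ (if c' ==ᶜ c then 1ℚ else 0ℚ)
  proper-absorbing {c} h c' =
    trans (prodFin-cong (λ i → playerProb-happy (proper-happy h i))) (prodFin-indicator (λ i → c' i ==ᶠ c i))

  unhappy : Coloring n q → ℕ
  unhappy c = count (not ∘ payoff G c) (allFin n)

  unhappy≤n : ∀ c → unhappy c ℕ.≤ n
  unhappy≤n c = count-allFin≤ (not ∘ payoff G c)

  improper⇒unhappy : ∀ c → T (not (proper G c)) → 1 ℕ.≤ unhappy c
  improper⇒unhappy c = count-not-all (payoff G c) (allFin n)

  unhappy-before : ∀ {c c' : Coloring n q} {i} → step G c c' ≢ 0ℚ →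
    T (not (payoff G c' i)) → T (not (payoff G c i))
  unhappy-before {c} {c'} {i} step≢0 unhappy′ with T-or-T-not (payoff G c i)
  ... | inj₁ happy   = ⊥-elim (T-not-¬ unhappy′ (happy-stays-happy step≢0 happy))
  ... | inj₂ unhappy = unhappy

  unhappy-mono : ∀ {c c' : Coloring n q} → step G c c' ≢ 0ℚ → unhappy c' ℕ.≤ unhappy c
  unhappy-mono step≢0 = count-mono (allFin n) (λ i → unhappy-before step≢0)

  unhappy-resp : ∀ {c c' : Coloring n q} → (∀ j → c j ≡ c' j) → unhappy c ≡ unhappy c'
  unhappy-resp {c} {c'} c≗c' = count-cong (allFin n) (λ i → cong not (payoff-resp i))
    where
    payoff-resp : ∀ i → payoff G c i ≡ payoff G c' i
    payoff-resp i = cong (λ bs → not (or bs))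
      (List.map-cong (λ j → cong₂ (λ x y → adj G i j ∧ (x ==ᶠ y)) (c≗c' j) (c≗c' i)) (allFin n))

  module _ (Δ+2≤q : maxDegree G ℕ.+ 2 ℕ.≤ q) where

    1≤q : 1 ℕ.≤ q
    1≤q = ℕ.≤-trans (s≤s z≤n) (ℕ.≤-trans (ℕ.m≤n+m 2 (maxDegree G)) Δ+2≤q)

    2≤nAvailable : ∀ c i → 2 ℕ.≤ nAvailable G c i
    2≤nAvailable c i = ℕ.+-cancelˡ-≤ used 2 (nAvailable G c i) (begin
      used ℕ.+ 2                 ≡⟨ ℕ.+-comm used 2 ⟩
      2 ℕ.+ used                 ≤⟨ ℕ.+-monoʳ-≤ 2 (ℕ.≤-trans (count-image (adj G i) c (allFin n))
                                                            (degree≤maxDegree G i)) ⟩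
      2 ℕ.+ maxDegree G          ≡⟨ ℕ.+-comm 2 (maxDegree G) ⟩
      maxDegree G ℕ.+ 2          ≤⟨ Δ+2≤q ⟩
      q                          ≡⟨ sym (trans (count-complement (usedByNbr G c i) (allFin q))
                                               (List.length-tabulate (λ k → k))) ⟩
      used ℕ.+ nAvailable G c i  ∎)
      where
      open ℕ.≤-Reasoning
      used = count (usedByNbr G c i) (allFin q)

    ∑-playerProb : ∀ c i → ∑[ k ∈ allFin q ] playerProb G c i k ≡ 1ℚ
    ∑-playerProb c i with T-or-T-not (payoff G c i)
    ... | inj₁ happy   = trans (∑-cong (allFin q) (λ k → playerProb-happy happy)) (∑-==ᶠ (c i))
    ... | inj₂ unhappy = begin
      ∑[ k ∈ allFin q ] playerProb G c i k
        ≡⟨ ∑-cong (allFin q) (λ k → trans (playerProb-unhappy unhappy) (sym (if-not (usedByNbr G c i k)))) ⟩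
      ∑[ k ∈ allFin q ] (if free c i k then inv m else 0ℚ)
        ≡⟨ ∑-indicator (free c i) (inv m) (allFin q) ⟩
      fromℕ m * inv m
        ≡⟨ fromℕ*inv m (ℕ.≤-trans (s≤s z≤n) (2≤nAvailable c i)) ⟩
      1ℚ ∎
      where
      open ≡-Reasoning
      m = nAvailable G c i

    step-stochastic : ∀ c → ∑[ c' ∈ allColorings n q ] step G c c' ≡ 1ℚ
    step-stochastic c = trans (∑-allColorings-prodFin n q (playerProb G c)) (prodFin-one (∑-playerProb c))

    module Successor
      (c : Coloring n q) (i₀ : Fin n) (i₀-unhappy : T (not (payoff G c i₀)))
      (a : Fin q) (a-free : T (free c i₀ a)) (avoid-a : ∀ j → ∃[ b ] T (free c j b) × b ≢ a)
      where

      target : Fin n → Fin q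
      target j = if j ==ᶠ i₀ then a else proj₁ (avoid-a j)

      target-free : ∀ j → T (free c j (target j))
      target-free j with T-or-T-not (j ==ᶠ i₀)
      ... | inj₁ j≡i₀ = subst (T ∘ free c j) (sym (if-T j≡i₀))
                              (subst (λ l → T (free c l a)) (sym (==ᶠ⇒≡ j≡i₀)) a-free)
      ... | inj₂ j≢i₀ = subst (T ∘ free c j) (sym (if-F j≢i₀)) (proj₁ (proj₂ (avoid-a j)))

      c⁺ : Coloring n q
      c⁺ j = if payoff G c j then c j else target j

      c⁺-happy : ∀ {j} → T (payoff G c j) → c⁺ j ≡ c j
      c⁺-happy = if-T

      c⁺-unhappy : ∀ {j} → T (not (payoff G c j)) → c⁺ j ≡ target j
      c⁺-unhappy = if-F

      c⁺-i₀ : c⁺ i₀ ≡ a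
      c⁺-i₀ = trans (c⁺-unhappy i₀-unhappy) (if-T (≡⇒==ᶠ {a = i₀} refl))

      c⁺-nbr≢a : ∀ j → T (adj G i₀ j) → c⁺ j ≢ a
      c⁺-nbr≢a j i₀j c⁺j≡a with T-or-T-not (payoff G c j)
      ... | inj₁ happy-j   = T-not-¬ a-free (usedByNbr⁺ i₀j (trans (sym (c⁺-happy happy-j)) c⁺j≡a))
      ... | inj₂ unhappy-j = proj₂ (proj₂ (avoid-a j)) (begin
        proj₁ (avoid-a j)  ≡⟨ sym (if-F (≢⇒not==ᶠ j≢i₀)) ⟩
        target j           ≡⟨ sym (c⁺-unhappy unhappy-j) ⟩
        c⁺ j               ≡⟨ c⁺j≡a ⟩
        a                  ∎)
        where
        open ≡-Reasoning
        j≢i₀ : j ≢ i₀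
        j≢i₀ refl = subst T (Graph.irrefl G i₀) i₀j

      i₀-happy : T (payoff G c⁺ i₀)
      i₀-happy with T-or-T-not (usedByNbr G c⁺ i₀ (c⁺ i₀))
      ... | inj₂ no-clash = no-clash
      ... | inj₁ clash with usedByNbr⁻ clash
      ...   | j , i₀j , c⁺j≡c⁺i₀ = ⊥-elim (c⁺-nbr≢a j i₀j (trans c⁺j≡c⁺i₀ c⁺-i₀))

      inv-q≤playerProb : ∀ j → inv q ≤ playerProb G c j (c⁺ j)
      inv-q≤playerProb j with T-or-T-not (payoff G c j)
      ... | inj₁ happy-j = ≤-trans (inv-antimono 1 q (s≤s z≤n) 1≤q)
        (≤-reflexive (sym (trans (playerProb-happy happy-j) (if-T (≡⇒==ᶠ (c⁺-happy happy-j))))))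
      ... | inj₂ unhappy-j = ≤-trans (inv-antimono m q 1≤m (count-allFin≤ (free c j)))
        (≤-reflexive (sym (trans (playerProb-unhappy unhappy-j) (if-F c⁺j-free))))
        where
        m = nAvailable G c j
        1≤m : 1 ℕ.≤ m
        1≤m = ℕ.≤-trans (s≤s z≤n) (2≤nAvailable c j)
        c⁺j-free : T (free c j (c⁺ j))
        c⁺j-free = subst (T ∘ free c j) (sym (c⁺-unhappy unhappy-j)) (target-free j)

      step-c⁺ : inv q ^ n ≤ step G c c⁺
      step-c⁺ = ^≤prodFin (inv-nonNeg q) inv-q≤playerProb

      step-c⁺≢0 : step G c c⁺ ≢ 0ℚ
      step-c⁺≢0 step≡0 =
        ℚ.<-irrefl refl (ℚ.<-≤-trans (^-pos n (inv-pos q 1≤q)) (≤-trans step-c⁺ (≤-reflexive step≡0)))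

      fewer-unhappy : unhappy c⁺ ℕ.< unhappy c
      fewer-unhappy = count-mono-< (λ i → unhappy-before step-c⁺≢0) (∈-allFin i₀) i₀-unhappy
                                   (λ i₀-unhappy⁺ → T-not-¬ i₀-unhappy⁺ i₀-happy)

    Progress : Coloring n q → Set
    Progress c = ∃[ c' ] c' ∈ allColorings n q × inv q ^ n ≤ step G c c' × unhappy c' ℕ.< unhappy c

    progress : ∀ c → 1 ℕ.≤ unhappy c → Progress c
    progress c 1≤unhappy = from-unhappy (count-witness (not ∘ payoff G c) (allFin n) 1≤unhappy)
      where
      from-unhappy : ∃[ i₀ ] i₀ ∈ allFin n × T (not (payoff G c i₀)) → Progress c
      from-unhappy (i₀ , _ , i₀-unhappy) = listed (allColorings-complete n q c⁺)
        where
        free-at-i₀ : ∃[ a ] a ∈ allFin q × T (free c i₀ a)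
        free-at-i₀ = count-witness (free c i₀) (allFin q) (ℕ.≤-trans (s≤s z≤n) (2≤nAvailable c i₀))
        a : Fin q
        a = proj₁ free-at-i₀
        avoid-a : ∀ j → ∃[ b ] T (free c j b) × b ≢ a
        avoid-a j = ∃-satisfier-≢ (free c j) (2≤nAvailable c j) a
        open Successor c i₀ i₀-unhappy a (proj₂ (proj₂ free-at-i₀)) avoid-a
        listed : ∃[ c' ] c' ∈ allColorings n q × (∀ j → c' j ≡ c⁺ j) → Progress c
        listed (c' , c'∈ , c'≗c⁺) = c' , c'∈
          , subst (inv q ^ n ≤_) (sym (step-resp c'≗c⁺)) step-c⁺
          , subst (ℕ._< unhappy c) (sym (unhappy-resp c'≗c⁺)) fewer-unhappy

    gain : Coloring n q → Coloring n q → ℚ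
    gain c c' = step G c c' * (fromℕ (unhappy c) - fromℕ (unhappy c'))

    gain-nonNeg : ∀ c c' → 0ℚ ≤ gain c c'
    gain-nonNeg c c' = by-cases (step G c c' ℚ.≟ 0ℚ)
      where
      drop = fromℕ (unhappy c) - fromℕ (unhappy c')
      by-cases : Dec (step G c c' ≡ 0ℚ) → 0ℚ ≤ gain c c'
      by-cases (yes step≡0) = ≤-reflexive (sym (trans (cong (_* drop) step≡0) (ℚ.*-zeroˡ drop)))
      by-cases (no step≢0)  = *-nonNeg (step-nonNeg c c') (p≤q⇒0≤q-p (fromℕ-mono-≤ (unhappy-mono step≢0)))

    δ : ℚ
    δ = inv q ^ n * inv (suc n)

    0<δ : 0ℚ < δ
    0<δ = *-pos (^-pos n (inv-pos q 1≤q)) (inv-pos (suc n) (s≤s z≤n))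

    δ≤1 : δ ≤ 1ℚ
    δ≤1 = *-mono-≤ (^-nonNeg n (inv-nonNeg q)) (^≤1 n (inv-nonNeg q) (inv-antimono 1 q (s≤s z≤n) 1≤q))
                   (inv-nonNeg (suc n)) (inv-antimono 1 (suc n) (s≤s z≤n) (s≤s z≤n))

    δ-unhappy≤ : ∀ c → δ * fromℕ (unhappy c) ≤ inv q ^ n
    δ-unhappy≤ c = begin
      δ * fromℕ (unhappy c)
        ≤⟨ *-monoˡ-≤ (<⇒≤ 0<δ) (fromℕ-mono-≤ (ℕ.≤-trans (unhappy≤n c) (ℕ.n≤1+n n))) ⟩
      δ * fromℕ (suc n)
        ≡⟨ ℚ.*-assoc (inv q ^ n) (inv (suc n)) (fromℕ (suc n)) ⟩
      inv q ^ n * (inv (suc n) * fromℕ (suc n))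
        ≡⟨ cong (inv q ^ n *_) (trans (ℚ.*-comm (inv (suc n)) (fromℕ (suc n)))
                                      (fromℕ*inv (suc n) (s≤s z≤n))) ⟩
      inv q ^ n * 1ℚ
        ≡⟨ ℚ.*-identityʳ (inv q ^ n) ⟩
      inv q ^ n ∎
      where open ℚ.≤-Reasoning

    expected-gain : ∀ c → δ * fromℕ (unhappy c) ≤ ∑[ c' ∈ allColorings n q ] gain c c'
    expected-gain c = by-cases (1 ℕ.≤? unhappy c)
      where
      Gain = ∑[ c' ∈ allColorings n q ] gain c c'
      via : Progress c → δ * fromℕ (unhappy c) ≤ Gain
      via (c' , c'∈ , step-bound , fewer) = begin
        δ * fromℕ (unhappy c)  ≤⟨ δ-unhappy≤ c ⟩
        inv q ^ n              ≤⟨ step-bound ⟩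
        step G c c'            ≡⟨ sym (ℚ.*-identityʳ (step G c c')) ⟩
        step G c c' * 1ℚ       ≤⟨ *-monoˡ-≤ (step-nonNeg c c') (1≤fromℕ-fromℕ fewer) ⟩
        gain c c'              ≤⟨ ∈⇒≤∑ (gain-nonNeg c) c'∈ ⟩
        Gain                   ∎
        where open ℚ.≤-Reasoning
      by-cases : Dec (1 ℕ.≤ unhappy c) → δ * fromℕ (unhappy c) ≤ Gain
      by-cases (yes 1≤unhappy) = via (progress c 1≤unhappy)
      by-cases (no ¬1≤unhappy) = begin
        δ * fromℕ (unhappy c)  ≡⟨ cong (λ m → δ * fromℕ m) unhappy≡0 ⟩
        δ * 0ℚ                 ≡⟨ ℚ.*-zeroʳ δ ⟩
        0ℚ                     ≤⟨ ∑-nonNeg (allColorings n q) (gain-nonNeg c) ⟩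
        Gain                   ∎
        where
        open ℚ.≤-Reasoning
        unhappy≡0 : unhappy c ≡ 0
        unhappy≡0 = ℕ.n≤0⇒n≡0 (ℕ.≮⇒≥ ¬1≤unhappy)

    drift : ∀ c → ∑[ c' ∈ allColorings n q ] step G c c' * fromℕ (unhappy c') ≤
                  (1ℚ - δ) * fromℕ (unhappy c)
    drift c = begin
      E                 ≤⟨ p≤p+q-r {E} {Gain} {δ * u} (expected-gain c) ⟩
      E + Gain - δ * u  ≡⟨ cong (_- δ * u) E+Gain≡u ⟩
      u - δ * u         ≡⟨ solve 2 (λ u d → u :- d :* u := (con 1ℚ :- d) :* u) refl u δ ⟩
      (1ℚ - δ) * u      ∎
      where
      open ℚ.≤-Reasoning
      open +-*-Solver
      AC = allColorings n q
      u = fromℕ (unhappy c)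
      E = ∑[ c' ∈ AC ] step G c c' * fromℕ (unhappy c')
      Gain = ∑[ c' ∈ AC ] gain c c'
      E+Gain≡u : E + Gain ≡ u
      E+Gain≡u = begin-equality
        E + Gain
          ≡⟨ sym (∑-distrib-+ AC _ (gain c)) ⟩
        ∑[ c' ∈ AC ] (step G c c' * fromℕ (unhappy c') + gain c c')
          ≡⟨ ∑-cong AC (λ c' → solve 3 (λ s v w → s :* w :+ s :* (v :- w) := s :* v) refl
                                       (step G c c') u (fromℕ (unhappy c'))) ⟩
        ∑[ c' ∈ AC ] step G c c' * u
          ≡⟨ sym (*-distribʳ-∑ u AC (step G c)) ⟩
        (∑[ c' ∈ AC ] step G c c') * u
          ≡⟨ cong (_* u) (step-stochastic c) ⟩
        1ℚ * u
          ≡⟨ ℚ.*-identityˡ u ⟩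
        u ∎

proposition2 : (n : ℕ) (G : Graph n) (q : ℕ) → maxDegree G ℕ.+ 2 ℕ.≤ q → (c₀ : Coloring n q)
    → ((ε : ℚ) → 0ℚ < ε → ∃[ T₀ ] ((t : ℕ) → T₀ ℕ.≤ t → (1ℚ - ε) ≤ probProperAt G c₀ t))
      × ((c : Coloring n q) → T (proper G c) → (c' : Coloring n q) → step G c c' ≡ (if c' ==ᶜ c then 1ℚ else 0ℚ))
proposition2 n G q Δ+2≤q c₀ = eventually-proper , λ c → proper-absorbing
  where
  open Dynamics {n} {q} G
  eventually-proper : (ε : ℚ) → 0ℚ < ε → ∃[ T₀ ] ((t : ℕ) → T₀ ℕ.≤ t → (1ℚ - ε) ≤ probProperAt G c₀ t)
  eventually-proper ε = Lyapunov.eventually-good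
    (allColorings n q) (step G) step-nonNeg (step-stochastic Δ+2≤q)
    (fromℕ ∘ unhappy) (proper G)
    (fromℕ-nonNeg ∘ unhappy) (λ c → fromℕ-mono-≤ (unhappy≤n c))
    (λ c → fromℕ-mono-≤ ∘ improper⇒unhappy c)
    (0<δ Δ+2≤q) (δ≤1 Δ+2≤q) (drift Δ+2≤q)
    (dist G c₀) (λ _ _ → refl) (point-mass-nonNeg c₀) (∑-point-mass c₀)
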